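{- Let $(\mathcal{B},\mathcal{P})$ be an impacted building, $\mathcal{O}\in\mathcal{P}$ a vertex, and $\mathcal{H}$ a way out from $\mathcal{O}$ with vertices $\mathcal{O}_0=\mathcal{O},\mathcal{O}_1,\mathcal{O}_2,\dots$ where $h(\mathcal{O}_n)=n$. Then for all $n\ge0$, $$\zeta^{\mathcal{P}}_{\mathcal{O}_{n+1}}(X)=\zeta_{\mathcal{O}_{n+1}}(X)+X\,\zeta^{\mathcal{P}}_{\mathcal{O}_n}(X).$$
   Context: An impacted building is a pair $(\mathcal{B},\mathcal{P})$ where $\mathcal{B}$ is a building of type $\widetilde{A}_1$ (a tree whose apartments are bi-infinite lines) and $\mathcal{P}$ is a connected subcomplex. Set $\mathcal{P}_0=\mathcal{P}$, $\mathcal{P}_n=\{x: d(x,\mathcal{P}_{n-1})\le1\}$, $\mathcal{R}_0=\mathcal{P}$, $\mathcal{R}_n=\mathcal{P}_n\setminus\mathcal{P}_{n-1}$, $h(v)$ the unique $n$ with $v\in\mathcal{R}_n$. $\zeta_v(X)=\sum_{d\ge0}\#\{x\in\mathcal{R}_{h(v)}: x\text{ reachable from } v \text{ by a path of length } d\}X^d$ and $\zeta^{\mathcal{P}}_v(X)$ is the same with $\mathcal{P}_{h(v)}$ in place of $\mathcal{R}_{h(v)}$ (paths are walks, possibly backtracking, not required to stay in any layer). A way out from $\mathcal{O}\in\mathcal{P}$ is a half-apartment (geodesic ray) $\mathcal{H}$ with boundary vertex $\mathcal{O}$ such that for each $n\ge0$ there is a unique vertex $\mathcal{O}_n\in\mathcal{H}$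 with $h(\mathcal{O}_n)=n$. -}

module Defs where

open import Data.Nat using (ℕ; zero; suc; _+_)
open import Data.Empty using (⊥)
open import Data.Unit using (⊤)
open import Data.Sum using (_⊎_)
open import Data.Product using (Σ; ∃; _×_; _,_)
open import Data.List using (List; length)
open import Data.List.Membership.Propositional using (_∈_)
open import Data.List.Relation.Unary.Unique.Propositional using (Unique)
open import Relation.Nullary using (¬_)
open import Relation.Binary.PropositionalEquality using (_≡_; _≢_)

data Walk {V : Set} (Adj : V → V → Set) : V → V → ℕ → Set where
  []  : ∀ {v} → Walk Adj v v 0
  _∷_ : ∀ {u v x d} → Adj u v → Walk Adj v x d → Walk Adj u x (suc d)

NonBacktracking : ∀ {V : Set} {Adj : V → V → Set} {u x d} → Walk Adj u x d → Set
NonBacktracking [] = ⊤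
NonBacktracking (_ ∷ []) = ⊤
NonBacktracking (_∷_ {u = u} _ (_∷_ {v = w} b p)) = (u ≢ w) × NonBacktracking (b ∷ p)

AllIn : ∀ {V : Set} {Adj : V → V → Set} → (V → Set) → ∀ {u x d} → Walk Adj u x d → Set
AllIn S (_∷_ {u = u} _ p) = S u × AllIn S p
AllIn S ([] {v = v}) = S v

-- Buildings of type Ã₁: thick trees (every vertex has ≥ 3 neighbours;
-- in particular no leaves, so apartments are bi-infinite lines).

record Building : Set₁ where
  field
    V       : Set
    Adj     : V → V → Set
    sym     : ∀ {x y} → Adj x y → Adj y x
    irrefl  : ∀ {x y} → Adj x y → x ≢ y
    connected : ∀ x y → ∃ λ d → Walk Adj x y d
    acyclic : ∀ x d (p : Walk Adj x x (suc d)) → ¬ NonBacktracking p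
    thick   : ∀ v → Σ V λ a → Σ V λ b → Σ V λ c →
                Adj v a × Adj v b × Adj v c × a ≢ b × a ≢ c × b ≢ c

-- Impacted building: a building with a connected subcomplex P
-- (in a tree a connected subcomplex is determined by its vertex set).
record ImpactedBuilding : Set₁ where
  field
    B : Building
  open Building B public
  field
    P : V → Set
    P-connected : ∀ x y → P x → P y →
      Σ ℕ λ d → Σ (Walk Adj x y d) λ p → AllIn P p

module _ (IB : ImpactedBuilding) where
  open ImpactedBuilding IB

  Layer≤ : ℕ → V → Set
  Layer≤ zero x = P x
  Layer≤ (suc n) x = Layer≤ n x ⊎ Σ V λ y → Adj x y × Layer≤ n y

  -- R_0 = P,  R_n = P_n \ P_{n-1};  h(v) = n  iff  Layer n v
  Layer : ℕ → V → Set
  Layer zero x = P x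
  Layer (suc n) x = Layer≤ (suc n) x × ¬ Layer≤ n x

  -- coefficient sets of ζ_v and ζ^P_v (for v with h(v) = n), degree d:
  -- the x in R_n (resp. P_n) reachable from v by a walk of length d
  ζset : ℕ → V → ℕ → V → Set
  ζset n v d x = Layer n x × Walk Adj v x d

  ζPset : ℕ → V → ℕ → V → Set
  ζPset n v d x = Layer≤ n x × Walk Adj v x d

  record WayOut (O : V) : Set where
    field
      ray       : ℕ → V
      ray-start : ray 0 ≡ O
      ray-adj   : ∀ i → Adj (ray i) (ray (suc i))
      ray-nb    : ∀ i → ray i ≢ ray (suc (suc i))
      meets     : ∀ n → ∃ λ i → Layer n (ray i)
      unique    : ∀ n i j → Layer n (ray i) → Layer n (ray j) → ray i ≡ ray j

-- multiplication by X on coefficient sets: (X·S)_0 = ∅, (X·S)_{d+1} = S_d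
shiftX : {V : Set} → (ℕ → V → Set) → ℕ → V → Set
shiftX S zero x = ⊥
shiftX S (suc d) x = S d x

HasCard : {V : Set} → (V → Set) → ℕ → Set
HasCard {V} S k = Σ (List V) λ l →
  Unique l × (∀ x → (x ∈ l → S x) × (S x → x ∈ l)) × length l ≡ k

-- For v = O_{n+1} and q = O_n the degree-d coefficient of ζ^P_v counts the
-- x ∈ P_{n+1} reachable from v in d steps.  Those outside P_n are counted by
-- ζ_v.  Those inside P_n are exactly the x reachable from q in d - 1 steps:
-- one direction prepends the edge v q, and for the other, since v ∉ P_n while
-- P_n is a connected subtree containing its neighbour q, every walk from v into
-- P_n must cross the edge v q, so its length exceeds that of a walk from q by 1.
-- The way-out hypothesis is what makes O_n and O_{n+1} adjacent: the ray is a
-- geodesic in a tree, hence injective, which forces h(ray i) = i.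
module Submission where

open import Defs
open import Data.Nat using (ℕ; zero; suc; _+_; _≤_; _<_; z≤n; s≤s)
open import Data.Nat.Properties using (_≟_; ≤-refl; ≤-antisym; ≤-trans; n≤1+n; +-suc; +-comm; m≤n⇒∃[o]m+o≡n; module ≤-Reasoning)
open import Data.Nat.Induction using (<-rec)
open import Data.Product using (∃; ∃₂; _×_; _,_; proj₁; proj₂)
open import Data.Sum using (_⊎_; inj₁; inj₂)
open import Data.Empty using (⊥; ⊥-elim)
open import Data.Unit using (tt)
open import Data.List using (List; []; _∷_; _++_; length)
open import Data.List.Properties using (length-++)
open import Data.List.Membership.Propositional using (_∈_)
open import Data.List.Membership.Propositional.Properties using (∈-++⁺ˡ; ∈-++⁺ʳ; ∈-∃++; ∈-++⁻)
open import Data.List.Relation.Binary.Subset.Propositional using (_⊆_)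
open import Data.List.Relation.Binary.Permutation.Propositional.Properties using (↭-length; shift)
open import Data.List.Relation.Unary.Any using (here; there)
import Data.List.Relation.Unary.All as All
open import Data.List.Relation.Unary.AllPairs using (_∷_)
open import Data.List.Relation.Unary.Unique.Propositional using (Unique)
open import Data.List.Relation.Unary.Unique.Propositional.Properties using (++⁺)
open import Effect.Monad using (RawMonad)
open import Level using (0ℓ)
open import Relation.Nullary using (¬_; Dec; yes; no)
open import Relation.Nullary.Negation using (DoubleNegation; ¬¬-Monad)
open import Relation.Nullary.Decidable using (¬¬-excluded-middle; decidable-stable)
open import Relation.Binary.PropositionalEquality using (_≡_; _≢_; refl; sym; trans; cong; subst; subst₂)

open RawMonad (¬¬-Monad {a = 0ℓ})

¬¬-decide : (A : Set) → DoubleNegation (Dec A)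
¬¬-decide A = ¬¬-excluded-middle

module _ {A : Set} where

  ∈-++-∷⁻ : ∀ {x y} (ys zs : List A) → y ≢ x → y ∈ ys ++ x ∷ zs → y ∈ ys ++ zs
  ∈-++-∷⁻ ys zs y≢x y∈ with ∈-++⁻ ys y∈
  ... | inj₁ y∈ys         = ∈-++⁺ˡ y∈ys
  ... | inj₂ (here y≡x)   = ⊥-elim (y≢x y≡x)
  ... | inj₂ (there y∈zs) = ∈-++⁺ʳ ys y∈zs

  Unique-⊆⇒length≤ : {xs ys : List A} → Unique xs → xs ⊆ ys → length xs ≤ length ys
  Unique-⊆⇒length≤ {[]} _ _ = z≤n
  Unique-⊆⇒length≤ {x ∷ xs} (x∉xs ∷ !xs) xs⊆ys with ∈-∃++ (xs⊆ys (here refl))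
  ... | ys , zs , refl = begin
    suc (length xs)           ≤⟨ s≤s (Unique-⊆⇒length≤ !xs xs⊆ys++zs) ⟩
    suc (length (ys ++ zs))   ≡⟨ sym (↭-length (shift x ys zs)) ⟩
    length (ys ++ x ∷ zs)     ∎
    where
    open ≤-Reasoning
    xs⊆ys++zs : xs ⊆ ys ++ zs
    xs⊆ys++zs y∈xs = ∈-++-∷⁻ ys zs (λ y≡x → All.lookup x∉xs y∈xs (sym y≡x)) (xs⊆ys (there y∈xs))

  -- The cover is only required up to double negation: membership in the
  -- sets of the theorem is not decidable, but the conclusion is.
  HasCard-partition : {S T U : A → Set} {a b c : ℕ} →
    HasCard S a → HasCard T b → HasCard U c →
    (∀ {x} → S x → DoubleNegation (T x ⊎ U x)) →
    (∀ {x} → T x → S x) → (∀ {x} → U x → S x) → (∀ {x} → T x → U x → ⊥) →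
    a ≡ b + c
  HasCard-partition {S} {T} {U} (xs , !xs , xs≐S , refl) (ys , !ys , ys≐T , refl) (zs , !zs , zs≐U , refl)
                    cover T⊆S U⊆S T∩U=∅ =
    decidable-stable (length xs ≟ length ys + length zs) do
      xs∈ys++zs ← All.sequenceM 0ℓ ¬¬-Monad (All.tabulate λ {x} x∈xs →
                    T⊎U⇒∈ys++zs <$> cover (proj₁ (xs≐S x) x∈xs))
      pure (trans (≤-antisym (Unique-⊆⇒length≤ !xs (All.lookup xs∈ys++zs)) (Unique-⊆⇒length≤ !ys++zs ys++zs⊆xs))
                  (length-++ ys))
    where
    T⊎U⇒∈ys++zs : ∀ {x} → T x ⊎ U x → x ∈ ys ++ zs
    T⊎U⇒∈ys++zs {x} (inj₁ Tx) = ∈-++⁺ˡ (proj₂ (ys≐T x) Tx)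
    T⊎U⇒∈ys++zs {x} (inj₂ Ux) = ∈-++⁺ʳ ys (proj₂ (zs≐U x) Ux)
    !ys++zs : Unique (ys ++ zs)
    !ys++zs = ++⁺ !ys !zs λ {x} (x∈ys , x∈zs) → T∩U=∅ (proj₁ (ys≐T x) x∈ys) (proj₁ (zs≐U x) x∈zs)
    ys++zs⊆xs : ys ++ zs ⊆ xs
    ys++zs⊆xs {x} x∈ with ∈-++⁻ ys x∈
    ... | inj₁ x∈ys = proj₂ (xs≐S x) (T⊆S (proj₁ (ys≐T x) x∈ys))
    ... | inj₂ x∈zs = proj₂ (xs≐S x) (U⊆S (proj₁ (zs≐U x) x∈zs))

module _ {V : Set} {Adj : V → V → Set} where

  _++ʷ_ : ∀ {u x z d e} → Walk Adj u x d → Walk Adj x z e → Walk Adj u z (d + e)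
  []      ++ʷ r = r
  (a ∷ p) ++ʷ r = a ∷ (p ++ʷ r)

  AllIn-++ : ∀ {S : V → Set} {u x z d e} (p : Walk Adj u x d) {r : Walk Adj x z e} →
    AllIn S p → AllIn S r → AllIn S (p ++ʷ r)
  AllIn-++ []      _        Sr = Sr
  AllIn-++ (_ ∷ p) (Su , Sp) Sr = Su , AllIn-++ p Sp Sr

  AllIn-mono : ∀ {S S' : V → Set} → (∀ {x} → S x → S' x) →
    ∀ {u x d} (p : Walk Adj u x d) → AllIn S p → AllIn S' p
  AllIn-mono S⊆S' []      Sx        = S⊆S' Sx
  AllIn-mono S⊆S' (_ ∷ p) (Su , Sp) = S⊆S' Su , AllIn-mono S⊆S' p Sp

  prefix-walk : (f : ℕ → V) → (∀ i → Adj (f i) (f (suc i))) → ∀ k → Walk Adj (f 0) (f k) k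
  prefix-walk f adj zero    = []
  prefix-walk f adj (suc k) = adj 0 ∷ prefix-walk (λ i → f (suc i)) (λ i → adj (suc i)) k

  prefix-walk-nonBacktracking : (f : ℕ → V) (adj : ∀ i → Adj (f i) (f (suc i))) →
    (∀ i → f i ≢ f (suc (suc i))) → ∀ k → NonBacktracking (prefix-walk f adj k)
  prefix-walk-nonBacktracking f adj nb zero          = tt
  prefix-walk-nonBacktracking f adj nb (suc zero)    = tt
  prefix-walk-nonBacktracking f adj nb (suc (suc k)) =
    nb 0 , prefix-walk-nonBacktracking (λ i → f (suc i)) (λ i → adj (suc i)) (λ i → nb (suc i)) (suc k)

module Tree (B : Building) where
  open Building B renaming (sym to Adj-sym)

  NonBacktracking⇒ends-distinct : ∀ {x y d} (w : Walk Adj x y (suc d)) → NonBacktracking w → y ≢ x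
  NonBacktracking⇒ends-distinct {x} {d = d} w nb refl = acyclic x d w nb

  nonBacktracking-sequence-never-returns : (f : ℕ → V) → (∀ i → Adj (f i) (f (suc i))) →
    (∀ i → f i ≢ f (suc (suc i))) → ∀ j → f (suc j) ≢ f 0
  nonBacktracking-sequence-never-returns f adj nb j =
    NonBacktracking⇒ends-distinct (prefix-walk f adj (suc j)) (prefix-walk-nonBacktracking f adj nb (suc j))

  module ThroughEdge {v q : V} (vq : Adj v q) where

    -- Geodesic k u w: a non-backtracking walk of length suc k from u to q
    -- whose first step goes to w and whose last edge is v q.
    data Geodesic : ℕ → V → V → Set where
      edge : Geodesic 0 v q
      push : ∀ {u y k w} → Adj u y → Geodesic k y w → u ≢ w → Geodesic (suc k) u y

    toWalk : ∀ {k u w} → Geodesic k u w → Walk Adj u q (suc k)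
    toWalk edge         = vq ∷ []
    toWalk (push a g _) = a ∷ toWalk g

    toWalk-nonBacktracking : ∀ {k u w} (g : Geodesic k u w) → NonBacktracking (toWalk g)
    toWalk-nonBacktracking edge                       = tt
    toWalk-nonBacktracking (push _ edge u≢w)          = u≢w , tt
    toWalk-nonBacktracking (push _ (push a g y≢w) u≢w) = u≢w , toWalk-nonBacktracking (push a g y≢w)

    ¬Geodesic-from-q : ∀ {k w} → ¬ Geodesic k q w
    ¬Geodesic-from-q g = NonBacktracking⇒ends-distinct (toWalk g) (toWalk-nonBacktracking g) refl

    module _ (S : V → Set) (v∉S : ¬ S v)
             (S-connected-to-q : ∀ {y} → S y → ∃₂ λ d (w : Walk Adj y q d) → AllIn S w) where

      -- Walking inside S only pushes onto the geodesic or pops from it, and it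
      -- can never pop the last edge since that would require leaving v.
      Geodesic-along-S : ∀ {k u w z m} → Geodesic k u w → (p : Walk Adj u z m) → AllIn S p →
        DoubleNegation (∃₂ λ k' w' → Geodesic k' z w')
      Geodesic-along-S g []      _ = pure (_ , _ , g)
      Geodesic-along-S edge (_ ∷ _) (Sv , _) = ⊥-elim (v∉S Sv)
      Geodesic-along-S (push {y = y} a g u≢w) (_∷_ {v = z} b p) (_ , Sp) = ¬¬-decide (z ≡ y) >>= λ where
        (yes refl) → Geodesic-along-S g p Sp
        (no z≢y)   → Geodesic-along-S (push (Adj-sym b) (push a g u≢w) z≢y) p Sp

      -- A walk ending in S must pop the whole geodesic, for otherwise continuing
      -- inside S to q would produce a non-backtracking closed walk at q.
      walk-from-Geodesic : ∀ {k u w x d} → Geodesic k u w → Walk Adj u x d → S x →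
        DoubleNegation (∃ λ e → d ≡ suc (k + e) × Walk Adj q x e)
      walk-after-pop : ∀ {k u y x d} → Geodesic k u y → Walk Adj y x d → S x →
        DoubleNegation (∃ λ e → suc d ≡ suc (k + e) × Walk Adj q x e)

      walk-from-Geodesic g [] Sx =
        let (_ , r , Sr) = S-connected-to-q Sx in
        Geodesic-along-S g r Sr >>= λ (_ , _ , g') → ⊥-elim (¬Geodesic-from-q g')
      walk-from-Geodesic {k} {w = w} g (_∷_ {v = y} a p) Sx = ¬¬-decide (y ≡ w) >>= λ where
        (yes refl) → walk-after-pop g p Sx
        (no y≢w)   → walk-from-Geodesic (push (Adj-sym a) g y≢w) p Sx >>= λ where
          (e , refl , r) → pure (suc (suc e) , cong suc (sym (trans (+-suc k (suc e)) (cong suc (+-suc k e)))) ,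
                                 Adj-sym vq ∷ vq ∷ r)

      walk-after-pop edge         p Sx = pure (_ , refl , p)
      walk-after-pop (push _ g _) p Sx = walk-from-Geodesic g p Sx >>= λ where
        (e , refl , r) → pure (e , refl , r)

      walk-into-S-crosses : ∀ {x d} → Walk Adj v x d → S x →
        DoubleNegation (∃ λ e → d ≡ suc e × Walk Adj q x e)
      walk-into-S-crosses = walk-from-Geodesic edge

module Layers (IB : ImpactedBuilding) where
  open ImpactedBuilding IB renaming (sym to Adj-sym)
  open Tree B

  Layer⇒Layer≤ : ∀ n {x} → Layer IB n x → Layer≤ IB n x
  Layer⇒Layer≤ zero    x∈R = x∈R
  Layer⇒Layer≤ (suc n) x∈R = proj₁ x∈R

  P⇒Layer≤ : ∀ n {x} → P x → Layer≤ IB n x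
  P⇒Layer≤ zero    Px = Px
  P⇒Layer≤ (suc n) Px = inj₁ (P⇒Layer≤ n Px)

  walk-to-P : ∀ n {x} → Layer≤ IB n x → ∃ λ p → P p × ∃₂ λ d (w : Walk Adj x p d) → AllIn (Layer≤ IB n) w
  walk-to-P zero Px = _ , Px , 0 , [] , Px
  walk-to-P (suc n) (inj₁ x∈Pₙ) =
    let (p , Pp , d , w , w⊆Pₙ) = walk-to-P n x∈Pₙ in p , Pp , d , w , AllIn-mono inj₁ w w⊆Pₙ
  walk-to-P (suc n) x∈P₊@(inj₂ (_ , a , y∈Pₙ)) =
    let (p , Pp , d , w , w⊆Pₙ) = walk-to-P n y∈Pₙ in p , Pp , suc d , a ∷ w , x∈P₊ , AllIn-mono inj₁ w w⊆Pₙ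

  walk-from-P : ∀ n {x} → Layer≤ IB n x → ∃ λ p → P p × ∃₂ λ d (w : Walk Adj p x d) → AllIn (Layer≤ IB n) w
  walk-from-P zero Px = _ , Px , 0 , [] , Px
  walk-from-P (suc n) (inj₁ x∈Pₙ) =
    let (p , Pp , d , w , w⊆Pₙ) = walk-from-P n x∈Pₙ in p , Pp , d , w , AllIn-mono inj₁ w w⊆Pₙ
  walk-from-P (suc n) x∈P₊@(inj₂ (_ , a , y∈Pₙ)) =
    let (p , Pp , d , w , w⊆Pₙ) = walk-from-P n y∈Pₙ in
    p , Pp , d + 1 , w ++ʷ (Adj-sym a ∷ []) , AllIn-++ w (AllIn-mono inj₁ w w⊆Pₙ) (inj₁ y∈Pₙ , x∈P₊)

  Layer≤-connected : ∀ n {x y} → Layer≤ IB n x → Layer≤ IB n y →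
    ∃₂ λ d (w : Walk Adj x y d) → AllIn (Layer≤ IB n) w
  Layer≤-connected n x∈Pₙ y∈Pₙ =
    let (p , Pp , _ , w , w⊆Pₙ)   = walk-to-P n x∈Pₙ
        (p' , Pp' , _ , w' , w'⊆Pₙ) = walk-from-P n y∈Pₙ
        (_ , r , r⊆P)             = P-connected p p' Pp Pp'
    in _ , w ++ʷ (r ++ʷ w') , AllIn-++ w w⊆Pₙ (AllIn-++ r (AllIn-mono (P⇒Layer≤ n) r r⊆P) w'⊆Pₙ)

  Layer≤⇒¬¬Layer : ∀ n {x} → Layer≤ IB n x → DoubleNegation (∃ λ m → m ≤ n × Layer IB m x)
  Layer≤⇒¬¬Layer zero    x∈P  = pure (0 , z≤n , x∈P)
  Layer≤⇒¬¬Layer (suc n) {x} x∈P₊ = ¬¬-decide (Layer≤ IB n x) >>= λ where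
    (yes x∈Pₙ) → Layer≤⇒¬¬Layer n x∈Pₙ >>= λ (m , m≤n , x∈Rₘ) → pure (m , ≤-trans m≤n (n≤1+n n) , x∈Rₘ)
    (no x∉Pₙ)  → pure (suc n , ≤-refl , x∈P₊ , x∉Pₙ)

  module _ {O : V} (O∈P : P O) (W : WayOut IB O) where
    open WayOut W

    ray-never-returns : ∀ m j → ray (suc j + m) ≢ ray m
    ray-never-returns m = nonBacktracking-sequence-never-returns
      (λ i → ray (i + m)) (λ i → ray-adj (i + m)) (λ i → ray-nb (i + m))

    -- ray (suc i) lies in P_{i+1}; were it in P_i it would lie in some R_m with
    -- m ≤ i, which already contains ray m, and the ray would return to ray m.
    ray-layer : ∀ i → Layer IB i (ray i)
    ray-layer = <-rec (λ i → Layer IB i (ray i)) layer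
      where
      layer : ∀ i → (∀ {m} → m < i → Layer IB m (ray m)) → Layer IB i (ray i)
      layer zero    _  = subst P (sym ray-start) O∈P
      layer (suc i) ih = inj₂ (ray i , Adj-sym (ray-adj i) , Layer⇒Layer≤ i (ih ≤-refl)) , λ r∈Pᵢ →
        Layer≤⇒¬¬Layer i r∈Pᵢ λ (m , m≤i , r∈Rₘ) →
          let (j , m+j≡i) = m≤n⇒∃[o]m+o≡n m≤i in
          ray-never-returns m j
            (trans (cong (λ t → ray (suc t)) (trans (+-comm j m) m+j≡i)) (unique m (suc i) m r∈Rₘ (ih (s≤s m≤i))))

    on-ray-in-layer : ∀ {k u} → (∃ λ i → ray i ≡ u) → Layer IB k u → u ≡ ray k
    on-ray-in-layer {k} (i , refl) u∈Rₖ = unique k i k u∈Rₖ (ray-layer k)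

theorem2p12 : (IB : ImpactedBuilding) → (O : ImpactedBuilding.V IB) →
  ImpactedBuilding.P IB O → (W : WayOut IB O) →
  (Ov : ℕ → ImpactedBuilding.V IB) →
  (∀ n → (∃ λ i → WayOut.ray W i ≡ Ov n) × Layer IB n (Ov n)) →
  ∀ n d a b c →
  HasCard (ζPset IB (suc n) (Ov (suc n)) d) a →
  HasCard (ζset IB (suc n) (Ov (suc n)) d) b →
  HasCard (shiftX (ζPset IB n (Ov n)) d) c →
  a ≡ b + c
theorem2p12 IB O O∈P W Ov Ov-on-ray n d a b c ζP₊ ζ₊ Xζ =
  HasCard-partition ζP₊ ζ₊ Xζ (classify d) (λ (x∈R₊ , w) → proj₁ x∈R₊ , w) (Xζ⊆ζP₊ d) (ζ₊∩Xζ=∅ d)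
  where
  open ImpactedBuilding IB renaming (sym to Adj-sym)
  open Layers IB
  open WayOut W
  open Tree.ThroughEdge B

  Ov≡ray : ∀ k → Ov k ≡ ray k
  Ov≡ray k = on-ray-in-layer O∈P W (proj₁ (Ov-on-ray k)) (proj₂ (Ov-on-ray k))

  vq : Adj (Ov (suc n)) (Ov n)
  vq = subst₂ Adj (sym (Ov≡ray (suc n))) (sym (Ov≡ray n)) (Adj-sym (ray-adj n))

  classify : ∀ d {x} → ζPset IB (suc n) (Ov (suc n)) d x →
    DoubleNegation (ζset IB (suc n) (Ov (suc n)) d x ⊎ shiftX (ζPset IB n (Ov n)) d x)
  classify d {x} (x∈P₊ , w) = ¬¬-decide (Layer≤ IB n x) >>= λ where
    (no x∉Pₙ)  → pure (inj₁ ((x∈P₊ , x∉Pₙ) , w))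
    (yes x∈Pₙ) → walk-into-S-crosses vq (Layer≤ IB n) (proj₂ (proj₂ (Ov-on-ray (suc n))))
                   (λ y∈Pₙ → Layer≤-connected n y∈Pₙ (Layer⇒Layer≤ n (proj₂ (Ov-on-ray n)))) w x∈Pₙ
                 >>= λ where (_ , refl , r) → pure (inj₂ (x∈Pₙ , r))

  Xζ⊆ζP₊ : ∀ d {x} → shiftX (ζPset IB n (Ov n)) d x → ζPset IB (suc n) (Ov (suc n)) d x
  Xζ⊆ζP₊ (suc _) (x∈Pₙ , w) = inj₁ x∈Pₙ , vq ∷ w

  ζ₊∩Xζ=∅ : ∀ d {x} → ζset IB (suc n) (Ov (suc n)) d x → shiftX (ζPset IB n (Ov n)) d x → ⊥
  ζ₊∩Xζ=∅ (suc _) ((_ , x∉Pₙ) , _) (x∈Pₙ , _) = x∉Pₙ x∈Pₙ
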